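{- Let $Q\subseteq H$ be a set of heavy vertices, and for each $q\in Q$ let $H_q$ be the $Q$-path of $q$. For any $Z\subseteq Q$, the polytope over which $\mathrm{LP_{FF}}(Z)$ optimizes is a face of the polytope describing the feasible region of $\mathrm{LP_{FF}}$. Consequently, any vertex solution of $\mathrm{LP_{FF}}(Z)$ is a vertex solution of $\mathrm{LP_{FF}}$.
   Context: Weighted Firefighter instance with general budgets: tree $G=(V,E)$ rooted at $r$ of depth $L$, weights $w(u)\in\mathbb{Z}_{\ge0}$ for $u\ne r$, budgets $B_\ell\in\mathbb{Z}_{>0}$. Notation: $V_{\le\ell}$ are vertices at distance $1,\dots,\ell$ from $r$; $\Gamma$ the leaves; $P_u$ the vertices of the $u$-$r$ path except $r$; $T_u$ the vertex set of the subtree rooted at $u$; $x(U)=\sum_{u\in U}x(u)$. $\mathrm{LP_{FF}}$: maximize $\sum_{u\in V\setminus\{r\}}x_u w(T_u)$ s.t. $x(P_u)\le1$ $\forall u\in\Gamma$, $x(V_{\le\ell})\le\sum_{i=1}^\ell B_i$ $\forall\ell\in[L]$, $x\in\mathbb{R}^{V\setminus\{r\}}_{\ge0}$. Given some $\eta>0$, $H=\{u\in V\setminus\{r\}\mid w(T_u)\ge\eta\}$ (heavy vertices). For $q\in Q$, the $Q$-path $H_q\subseteq H$ is the set of vertices visited when traversing $P_q$ from $q$ towards $r$ until (but not including) the next vertex in $Q\cup\{r\}$. $\mathrm{LP_{FF}}(Z)$ is $\mathrm{LP_{FF}}$ with the additional constraints $x(H_q)=1$ for $q\in Z$ and $x(H_q)=0$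 for $q\in Q\setminus Z$.
   Formalization: Points of the polytopes of $\mathrm{LP_{FF}}$ and $\mathrm{LP_{FF}}(Z)$ have rational coordinates instead of real ones, and the threshold η, the coefficients of the face inequality and the convex-combination weights are rational. -}

module Defs where

open import Data.Nat as ℕ using (ℕ; zero; suc; _⊔_)
open import Data.Fin using (Fin; toℕ)
import Data.Fin.Properties as FinP
open import Data.Fin.Subset using (Subset; _∈_; _∉_)
open import Data.Fin.Subset.Properties using () renaming (_∈?_ to _∈S?_)
open import Data.Maybe using (Maybe; just; nothing)
open import Data.List using (List; []; _∷_; length; map; foldr; filter; takeWhile; drop; allFin)
import Data.List.Membership.DecPropositional as DecMem
open import Data.Rational using (ℚ; 0ℚ; 1ℚ; _+_; _*_; _-_; _≤_; _<_; _/_)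
open import Data.Integer using (+_)
open import Data.Product using (_×_; Σ; ∃)
open import Relation.Nullary using (¬_)
open import Relation.Nullary.Decidable using (¬?)
open import Relation.Binary.PropositionalEquality using (_≡_; _≢_)
open import Function.Bundles using (_⇔_)

ℕ→ℚ : ℕ → ℚ
ℕ→ℚ k = + k / 1

-- A rooted tree: the root r is implicit; the non-root vertices are Fin n.
-- parent v = nothing means the parent of v is the root r.
-- Vertices are labelled so that parents have smaller labels (any rooted
-- tree admits such a labelling, e.g. BFS order); this guarantees acyclicity.
record Tree (n : ℕ) : Set where
  field
    parent  : Fin n → Maybe (Fin n)
    ordered : ∀ v w → parent v ≡ just w → toℕ w ℕ.< toℕ v

sumOver : ∀ {n} → List (Fin n) → (Fin n → ℚ) → ℚ
sumOver U x = foldr (λ v acc → x v + acc) 0ℚ U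

sumOverℕ : ∀ {n} → List (Fin n) → (Fin n → ℕ) → ℕ
sumOverℕ U w = foldr (λ v acc → w v ℕ.+ acc) 0 U

budgetSum : (ℕ → ℕ) → ℕ → ℕ
budgetSum B zero    = 0
budgetSum B (suc ℓ) = budgetSum B ℓ ℕ.+ B (suc ℓ)

module FF {n : ℕ} (G : Tree n) where
  open Tree G
  open DecMem (FinP._≟_ {n}) using (_∈?_)

  pathF : ℕ → Fin n → List (Fin n)
  pathF zero    v = v ∷ []
  pathF (suc k) v with parent v
  ... | nothing = v ∷ []
  ... | just w  = v ∷ pathF k w

  -- P_u : vertices of the u-r path except r (fuel n suffices by 'ordered')
  P : Fin n → List (Fin n)
  P u = pathF n u

  depth : Fin n → ℕ
  depth v = length (P v)

  L : ℕ
  L = foldr _⊔_ 0 (map depth (allFin n))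

  Vle : ℕ → List (Fin n)
  Vle ℓ = filter (λ v → depth v ℕ.≤? ℓ) (allFin n)

  IsLeaf : Fin n → Set
  IsLeaf v = ∀ w → parent w ≢ just v

  Tsub : Fin n → List (Fin n)
  Tsub u = filter (λ w → u ∈? P w) (allFin n)

  wT : (Fin n → ℕ) → Fin n → ℚ
  wT w u = ℕ→ℚ (sumOverℕ (Tsub u) w)

  Heavy : (Fin n → ℕ) → ℚ → Fin n → Set
  Heavy w η u = η ≤ wT w u

  Hpath : Subset n → Fin n → List (Fin n)
  Hpath Q q = q ∷ takeWhile (λ v → ¬? (v ∈S? Q)) (drop 1 (P q))

  FeasFF : (ℕ → ℕ) → (Fin n → ℚ) → Set
  FeasFF B x =
      (∀ v → 0ℚ ≤ x v)
    × (∀ u → IsLeaf u → sumOver (P u) x ≤ 1ℚ)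
    × (∀ ℓ → 1 ℕ.≤ ℓ → ℓ ℕ.≤ L → sumOver (Vle ℓ) x ≤ ℕ→ℚ (budgetSum B ℓ))

  FeasFFZ : (ℕ → ℕ) → Subset n → Subset n → (Fin n → ℚ) → Set
  FeasFFZ B Q Z x =
      FeasFF B x
    × (∀ q → q ∈ Q → q ∈ Z → sumOver (Hpath Q q) x ≡ 1ℚ)
    × (∀ q → q ∈ Q → q ∉ Z → sumOver (Hpath Q q) x ≡ 0ℚ)

dot : ∀ {n} → (Fin n → ℚ) → (Fin n → ℚ) → ℚ
dot c x = sumOver (allFin _) (λ i → c i * x i)

IsFace : ∀ {n} → ((Fin n → ℚ) → Set) → ((Fin n → ℚ) → Set) → Set
IsFace {n} Pol F =
  Σ (Fin n → ℚ) λ c → Σ ℚ λ δ →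
      (∀ x → Pol x → dot c x ≤ δ)
    × (∀ x → F x ⇔ (Pol x × dot c x ≡ δ))

IsVertex : ∀ {n} → ((Fin n → ℚ) → Set) → (Fin n → ℚ) → Set
IsVertex {n} Pol x =
  Pol x ×
  (∀ y z λ' → Pol y → Pol z → 0ℚ < λ' → λ' < 1ℚ →
     (∀ i → x i ≡ λ' * y i + (1ℚ - λ') * z i) → ∀ i → y i ≡ x i)

-- For q ∈ Q every feasible x satisfies 0 ≤ x(H_q) ≤ 1, because H_q lies on the
-- path from some leaf to the root.  Hence x(H_q) ≤ 1 for q ∈ Z and −x(H_q) ≤ 0
-- for q ∈ Q ∖ Z are valid inequalities for LP_FF, and LP_FF(Z) is the set where
-- all of them are tight, i.e. where their sum is tight: a face.  A point that
-- is a convex combination of feasible points and lies on a face forces both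
-- points onto the face, so vertices of the face are vertices of the polytope.
module Submission where

open import Defs
open import Data.Nat using (ℕ; _≤_; _<_)
open import Data.Fin using (Fin)
open import Data.Fin.Subset using (Subset; _∈_; _⊆_)
open import Data.Rational using (ℚ; 0ℚ)
open import Data.Product using (_×_)

import Data.Nat as ℕ
import Data.Nat.Properties as ℕP
import Data.Fin as Fin
import Data.Fin.Properties as FinP
open import Data.Fin.Subset.Properties using (_∈?_)
open import Data.Rational as ℚ using (1ℚ; _+_; _*_; _-_; -_; Positive)
  renaming (_≤_ to _≤ℚ_; _<_ to _<ℚ_)
import Data.Rational.Properties as ℚP
open import Data.Product using (Σ; ∃; _,_; proj₁; proj₂)
open import Data.List using (List; []; _∷_; _++_; takeWhile; allFin; tabulate)
import Data.List.Properties as ListP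
open import Data.List.Relation.Unary.All as All using (All; []; _∷_)
open import Data.List.Membership.Propositional.Properties using (∈-allFin)
open import Data.Maybe using (Maybe; just; nothing)
import Data.Maybe.Properties as MaybeP
open import Data.Bool using (true; false; if_then_else_)
open import Data.Empty using (⊥-elim)
open import Function using (_∘_)
open import Function.Bundles using (_⇔_; mk⇔; Equivalence)
open import Level using (0ℓ)
open import Relation.Binary.PropositionalEquality
open import Relation.Nullary using (Dec; yes; no; does; ¬_)
open import Tactic.RingSolver using (solve-∀)
import Tactic.RingSolver.Core.AlmostCommutativeRing as ACR

ℚ-ring : ACR.AlmostCommutativeRing 0ℓ 0ℓ
ℚ-ring = ACR.fromCommutativeRing ℚP.+-*-commutativeRing isZero
  where
  isZero : ∀ x → Maybe (0ℚ ≡ x)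
  isZero x with 0ℚ ℚ.≟ x
  ... | yes p = just p
  ... | no _  = nothing

≤-+-≡⇒≡ : ∀ {p q p′ q′} → p ≤ℚ q → p′ ≤ℚ q′ → p + p′ ≡ q + q′ → p ≡ q × p′ ≡ q′
≤-+-≡⇒≡ p≤q p′≤q′ eq =
  ℚP.≤-antisym p≤q (ℚP.≮⇒≥ λ p<q → ℚP.<-irrefl eq (ℚP.+-mono-<-≤ p<q p′≤q′)) ,
  ℚP.≤-antisym p′≤q′ (ℚP.≮⇒≥ λ p′<q′ → ℚP.<-irrefl eq (ℚP.+-mono-≤-< p≤q p′<q′))

*-cancelˡ-≡-pos : ∀ r {p q} .{{_ : Positive r}} → r * p ≡ r * q → p ≡ q
*-cancelˡ-≡-pos r eq =
  ℚP.≤-antisym (ℚP.*-cancelˡ-≤-pos r (ℚP.≤-reflexive eq))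
               (ℚP.*-cancelˡ-≤-pos r (ℚP.≤-reflexive (sym eq)))

convex-≤-tight : ∀ {l b d δ} → 0ℚ <ℚ l → l <ℚ 1ℚ → b ≤ℚ δ → d ≤ℚ δ
  → l * b + (1ℚ - l) * d ≡ δ → b ≡ δ × d ≡ δ
convex-≤-tight {l} {b} {d} {δ} 0<l l<1 b≤δ d≤δ eq =
  *-cancelˡ-≡-pos l (proj₁ tight) , *-cancelˡ-≡-pos (1ℚ - l) (proj₂ tight)
  where
  0<1-l : 0ℚ <ℚ 1ℚ - l
  0<1-l = subst (_<ℚ 1ℚ - l) (ℚP.+-inverseʳ l) (ℚP.+-monoˡ-< (- l) l<1)
  instance
    l-pos : Positive l
    l-pos = ℚ.positive 0<l
    1-l-pos : Positive (1ℚ - l)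
    1-l-pos = ℚ.positive 0<1-l
    l-nonNeg : ℚ.NonNegative l
    l-nonNeg = ℚP.pos⇒nonNeg l
    1-l-nonNeg : ℚ.NonNegative (1ℚ - l)
    1-l-nonNeg = ℚP.pos⇒nonNeg (1ℚ - l)
  split : ∀ l δ → l * δ + (1ℚ - l) * δ ≡ δ
  split = solve-∀ ℚ-ring
  tight : l * b ≡ l * δ × (1ℚ - l) * d ≡ (1ℚ - l) * δ
  tight = ≤-+-≡⇒≡ (ℚP.*-monoˡ-≤-nonNeg l b≤δ) (ℚP.*-monoˡ-≤-nonNeg (1ℚ - l) d≤δ)
                  (trans eq (sym (split l δ)))

module _ {n : ℕ} where

  sumOver-cong : ∀ (L : List (Fin n)) {f g : Fin n → ℚ} → (∀ i → f i ≡ g i)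
    → sumOver L f ≡ sumOver L g
  sumOver-cong []      f≡g = refl
  sumOver-cong (v ∷ L) f≡g = cong₂ _+_ (f≡g v) (sumOver-cong L f≡g)

  sumOver-mono : ∀ (L : List (Fin n)) {f g : Fin n → ℚ} → (∀ i → f i ≤ℚ g i)
    → sumOver L f ≤ℚ sumOver L g
  sumOver-mono []      f≤g = ℚP.≤-refl
  sumOver-mono (v ∷ L) f≤g = ℚP.+-mono-≤ (f≤g v) (sumOver-mono L f≤g)

  sumOver-nonNeg : ∀ (L : List (Fin n)) {x : Fin n → ℚ} → (∀ i → 0ℚ ≤ℚ x i)
    → 0ℚ ≤ℚ sumOver L x
  sumOver-nonNeg []      x≥0 = ℚP.≤-refl
  sumOver-nonNeg (v ∷ L) x≥0 = ℚP.+-mono-≤ (x≥0 v) (sumOver-nonNeg L x≥0)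

  sumOver-zero : ∀ (L : List (Fin n)) {f : Fin n → ℚ} → (∀ i → f i ≡ 0ℚ) → sumOver L f ≡ 0ℚ
  sumOver-zero []      f≡0 = refl
  sumOver-zero (v ∷ L) f≡0 = trans (cong₂ _+_ (f≡0 v) (sumOver-zero L f≡0)) (ℚP.+-identityˡ 0ℚ)

  sumOver-++ : ∀ (A B : List (Fin n)) (x : Fin n → ℚ)
    → sumOver (A ++ B) x ≡ sumOver A x + sumOver B x
  sumOver-++ []      B x = sym (ℚP.+-identityˡ _)
  sumOver-++ (v ∷ A) B x = trans (cong (x v +_) (sumOver-++ A B x)) (sym (ℚP.+-assoc (x v) _ _))

  sumOver-+ : ∀ (L : List (Fin n)) (f g : Fin n → ℚ)
    → sumOver L (λ i → f i + g i) ≡ sumOver L f + sumOver L g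
  sumOver-+ []      f g = sym (ℚP.+-identityˡ 0ℚ)
  sumOver-+ (v ∷ L) f g =
    trans (cong ((f v + g v) +_) (sumOver-+ L f g)) (interchange (f v) (g v) _ _)
    where
    interchange : ∀ a b c d → (a + b) + (c + d) ≡ (a + c) + (b + d)
    interchange = solve-∀ ℚ-ring

  sumOver-*ˡ : ∀ (L : List (Fin n)) (k : ℚ) (f : Fin n → ℚ)
    → sumOver L (λ i → k * f i) ≡ k * sumOver L f
  sumOver-*ˡ []      k f = sym (ℚP.*-zeroʳ k)
  sumOver-*ˡ (v ∷ L) k f =
    trans (cong (k * f v +_) (sumOver-*ˡ L k f)) (sym (ℚP.*-distribˡ-+ k (f v) _))

  sumOver-*ʳ : ∀ (L : List (Fin n)) (k : ℚ) (f : Fin n → ℚ)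
    → sumOver L (λ i → f i * k) ≡ sumOver L f * k
  sumOver-*ʳ []      k f = sym (ℚP.*-zeroˡ k)
  sumOver-*ʳ (v ∷ L) k f =
    trans (cong (f v * k +_) (sumOver-*ʳ L k f)) (sym (ℚP.*-distribʳ-+ k (f v) _))

  sumOver-≤-tight : ∀ (L : List (Fin n)) {f g : Fin n → ℚ} → (∀ i → f i ≤ℚ g i)
    → sumOver L f ≡ sumOver L g → All (λ i → f i ≡ g i) L
  sumOver-≤-tight []      f≤g eq = []
  sumOver-≤-tight (v ∷ L) f≤g eq with ≤-+-≡⇒≡ (f≤g v) (sumOver-mono L f≤g) eq
  ... | head , rest = head ∷ sumOver-≤-tight L f≤g rest

  sumOver-takeWhile-≤ : ∀ {p} {P : Fin n → Set p} (P? : ∀ v → Dec (P v)) (L : List (Fin n))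
    {x : Fin n → ℚ} → (∀ i → 0ℚ ≤ℚ x i) → sumOver (takeWhile P? L) x ≤ℚ sumOver L x
  sumOver-takeWhile-≤ P? []      x≥0 = ℚP.≤-refl
  sumOver-takeWhile-≤ P? (v ∷ L) {x} x≥0 with does (P? v)
  ... | true  = ℚP.+-monoʳ-≤ (x v) (sumOver-takeWhile-≤ P? L x≥0)
  ... | false = ℚP.+-mono-≤ (x≥0 v) (sumOver-nonNeg L x≥0)

  sumOver-suffix-≤ : ∀ (A B : List (Fin n)) {x : Fin n → ℚ} → (∀ i → 0ℚ ≤ℚ x i)
    → sumOver B x ≤ℚ sumOver (A ++ B) x
  sumOver-suffix-≤ A B {x} x≥0 =
    subst₂ _≤ℚ_ (ℚP.+-identityˡ _) (sym (sumOver-++ A B x))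
           (ℚP.+-monoˡ-≤ (sumOver B x) (sumOver-nonNeg A x≥0))

sumOver-swap : ∀ {m n} (A : List (Fin m)) (B : List (Fin n)) (f : Fin m → Fin n → ℚ)
  → sumOver A (λ i → sumOver B (f i)) ≡ sumOver B (λ j → sumOver A (λ i → f i j))
sumOver-swap []      B f = sym (sumOver-zero B (λ _ → refl))
sumOver-swap (a ∷ A) B f =
  trans (cong (sumOver B (f a) +_) (sumOver-swap A B f))
        (sym (sumOver-+ B (f a) (λ j → sumOver A (λ i → f i j))))

sumOver-tabulate : ∀ {m n} (f : Fin m → Fin n) (x : Fin n → ℚ)
  → sumOver (tabulate f) x ≡ sumOver (allFin m) (x ∘ f)
sumOver-tabulate {ℕ.zero}  f x = refl
sumOver-tabulate {ℕ.suc m} f x = cong (x (f Fin.zero) +_)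
  (trans (sumOver-tabulate (f ∘ Fin.suc) x) (sym (sumOver-tabulate Fin.suc (x ∘ f))))

unitVec : ∀ {n} → Fin n → Fin n → ℚ
unitVec v i = if does (v FinP.≟ i) then 1ℚ else 0ℚ

indicator : ∀ {n} → List (Fin n) → Fin n → ℚ
indicator L i = sumOver L (λ v → unitVec v i)

dot-unitVec : ∀ {n} (v : Fin n) (x : Fin n → ℚ) → dot (unitVec v) x ≡ x v
dot-unitVec {ℕ.suc n} Fin.zero x = begin
  1ℚ * x Fin.zero + sumOver (tabulate (Fin.suc {n})) (λ i → unitVec Fin.zero i * x i)
    ≡⟨ cong₂ _+_ (ℚP.*-identityˡ (x Fin.zero)) (sumOver-tabulate Fin.suc (λ i → unitVec Fin.zero i * x i)) ⟩
  x Fin.zero + sumOver (allFin n) (λ i → 0ℚ * x (Fin.suc i))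
    ≡⟨ cong (x Fin.zero +_) (sumOver-zero (allFin n) (λ i → ℚP.*-zeroˡ (x (Fin.suc i)))) ⟩
  x Fin.zero + 0ℚ
    ≡⟨ ℚP.+-identityʳ _ ⟩
  x Fin.zero ∎
  where open ≡-Reasoning
dot-unitVec {ℕ.suc n} (Fin.suc v) x = begin
  0ℚ * x Fin.zero + sumOver (tabulate (Fin.suc {n})) (λ i → unitVec (Fin.suc v) i * x i)
    ≡⟨ cong₂ _+_ (ℚP.*-zeroˡ (x Fin.zero)) (sumOver-tabulate Fin.suc (λ i → unitVec (Fin.suc v) i * x i)) ⟩
  0ℚ + dot (unitVec v) (x ∘ Fin.suc)
    ≡⟨ ℚP.+-identityˡ _ ⟩
  dot (unitVec v) (x ∘ Fin.suc)
    ≡⟨ dot-unitVec v (x ∘ Fin.suc) ⟩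
  x (Fin.suc v) ∎
  where open ≡-Reasoning

dot-indicator : ∀ {n} (L : List (Fin n)) (x : Fin n → ℚ) → dot (indicator L) x ≡ sumOver L x
dot-indicator {n} L x = begin
  sumOver (allFin n) (λ i → indicator L i * x i)
    ≡⟨ sumOver-cong (allFin n) (λ i → sym (sumOver-*ʳ L (x i) (λ v → unitVec v i))) ⟩
  sumOver (allFin n) (λ i → sumOver L (λ v → unitVec v i * x i))
    ≡⟨ sumOver-swap (allFin n) L (λ i v → unitVec v i * x i) ⟩
  sumOver L (λ v → dot (unitVec v) x)
    ≡⟨ sumOver-cong L (λ v → dot-unitVec v x) ⟩
  sumOver L x ∎
  where open ≡-Reasoning

dot-*ˡ : ∀ {n} (k : ℚ) (c x : Fin n → ℚ) → dot (λ i → k * c i) x ≡ k * dot c x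
dot-*ˡ {n} k c x = trans (sumOver-cong (allFin n) (λ i → ℚP.*-assoc k (c i) (x i)))
                         (sumOver-*ˡ (allFin n) k (λ i → c i * x i))

dot-sum : ∀ {m n} (c : Fin m → Fin n → ℚ) (x : Fin n → ℚ)
  → dot (λ i → sumOver (allFin m) (λ k → c k i)) x ≡ sumOver (allFin m) (λ k → dot (c k) x)
dot-sum {m} {n} c x =
  trans (sumOver-cong (allFin n) (λ i → sym (sumOver-*ʳ (allFin m) (x i) (λ k → c k i))))
        (sumOver-swap (allFin n) (allFin m) (λ i k → c k i * x i))

dot-convex : ∀ {n} (c x y z : Fin n → ℚ) (l : ℚ) → (∀ i → x i ≡ l * y i + (1ℚ - l) * z i)
  → dot c x ≡ l * dot c y + (1ℚ - l) * dot c z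
dot-convex {n} c x y z l x≡ = begin
  sumOver (allFin n) (λ i → c i * x i)
    ≡⟨ sumOver-cong (allFin n) (λ i → trans (cong (c i *_) (x≡ i)) (distrib l (c i) (y i) (z i))) ⟩
  sumOver (allFin n) (λ i → l * (c i * y i) + (1ℚ - l) * (c i * z i))
    ≡⟨ sumOver-+ (allFin n) (λ i → l * (c i * y i)) (λ i → (1ℚ - l) * (c i * z i)) ⟩
  sumOver (allFin n) (λ i → l * (c i * y i)) + sumOver (allFin n) (λ i → (1ℚ - l) * (c i * z i))
    ≡⟨ cong₂ _+_ (sumOver-*ˡ (allFin n) l _) (sumOver-*ˡ (allFin n) (1ℚ - l) _) ⟩
  l * dot c y + (1ℚ - l) * dot c z ∎
  where
  open ≡-Reasoning
  distrib : ∀ l c y z → c * (l * y + (1ℚ - l) * z) ≡ l * (c * y) + (1ℚ - l) * (c * z)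
  distrib = solve-∀ ℚ-ring

-- The face is cut out by the single inequality obtained by summing the family.
IsFace-tightFamily : ∀ {m n} (Pol F : (Fin n → ℚ) → Set) (c : Fin m → Fin n → ℚ) (t : Fin m → ℚ)
  → (∀ x → Pol x → ∀ k → dot (c k) x ≤ℚ t k)
  → (∀ x → F x ⇔ (Pol x × ∀ k → dot (c k) x ≡ t k))
  → IsFace Pol F
IsFace-tightFamily {m} Pol F c t valid F⇔tight = csum , sumOver (allFin m) t , valid′ , F⇔
  where
  csum = λ i → sumOver (allFin m) (λ k → c k i)
  valid′ : ∀ x → Pol x → dot csum x ≤ℚ sumOver (allFin m) t
  valid′ x Px = subst (_≤ℚ _) (sym (dot-sum c x)) (sumOver-mono (allFin m) (valid x Px))
  F⇔ : ∀ x → F x ⇔ (Pol x × dot csum x ≡ sumOver (allFin m) t)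
  F⇔ x = mk⇔
    (λ Fx → let Px , tight = Equivalence.to (F⇔tight x) Fx in
             Px , trans (dot-sum c x) (sumOver-cong (allFin m) tight))
    (λ (Px , eq) → Equivalence.from (F⇔tight x)
      (Px , λ k → All.lookup (sumOver-≤-tight (allFin m) (valid x Px) (trans (sym (dot-sum c x)) eq))
                             (∈-allFin k)))

IsFace⇒IsVertex : ∀ {n} (Pol F : (Fin n → ℚ) → Set) → IsFace Pol F
  → ∀ x → IsVertex F x → IsVertex Pol x
IsFace⇒IsVertex Pol F (c , δ , valid , F⇔) x (Fx , extreme) =
  proj₁ (to Fx) , λ y z l Py Pz 0<l l<1 x≡ →
    let y-tight , z-tight = convex-≤-tight 0<l l<1 (valid y Py) (valid z Pz)
                              (trans (sym (dot-convex c x y z l x≡)) (proj₂ (to Fx)))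
    in extreme y z l (from (Py , y-tight)) (from (Pz , z-tight)) 0<l l<1 x≡
  where
  to   = λ {x} → Equivalence.to (F⇔ x)
  from = λ {x} → Equivalence.from (F⇔ x)

module _ {n : ℕ} (G : Tree n) where
  open Tree G
  open FF G

  pathF-saturated : ∀ k v → Fin.toℕ v ≤ k → pathF k v ≡ pathF (ℕ.suc k) v
  pathF-saturated ℕ.zero v v≤0 with parent v in pv
  ... | nothing = refl
  ... | just w  = ⊥-elim (ℕP.<⇒≱ (ℕP.<-≤-trans (ordered v w pv) v≤0) ℕ.z≤n)
  pathF-saturated (ℕ.suc k) v v≤k with parent v in pv
  ... | nothing = refl
  ... | just w  = cong (v ∷_) (pathF-saturated k w (ℕP.≤-pred (ℕP.≤-trans (ordered v w pv) v≤k)))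

  pathF-head : ∀ k v → ∃ λ rest → pathF k v ≡ v ∷ rest
  pathF-head ℕ.zero    v = [] , refl
  pathF-head (ℕ.suc k) v with parent v
  ... | nothing = [] , refl
  ... | just w  = pathF k w , refl

  pathF-child : ∀ m {q w} → parent w ≡ just q → Fin.toℕ w < m → pathF m w ≡ w ∷ pathF m q
  pathF-child (ℕ.suc k) {q} {w} pw w<m rewrite pw =
    cong (w ∷_) (pathF-saturated k q (ℕP.<⇒≤ (ℕP.<-≤-trans (ordered w q pw) (ℕP.≤-pred w<m))))

  -- Fuel argument: each step descends to a child, whose label is strictly larger.
  leaf-below : ∀ fuel q → n ≤ fuel ℕ.+ Fin.toℕ q
    → Σ (Fin n) λ u → IsLeaf u × ∃ λ pre → P u ≡ pre ++ P q
  leaf-below ℕ.zero q n≤q = ⊥-elim (ℕP.<⇒≱ (FinP.toℕ<n q) n≤q)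
  leaf-below (ℕ.suc fuel) q n≤fuel+q
    with FinP.any? (λ w → MaybeP.≡-dec FinP._≟_ (parent w) (just q))
  ... | no no-child = q , (λ w pw → no-child (w , pw)) , [] , refl
  ... | yes (w , pw) with leaf-below fuel w
        (ℕP.≤-trans n≤fuel+q (ℕP.≤-trans (ℕP.≤-reflexive (sym (ℕP.+-suc fuel (Fin.toℕ q))))
                                          (ℕP.+-monoʳ-≤ fuel (ordered w q pw))))
  ... | u , u-leaf , pre , Pu≡ =
    u , u-leaf , pre ++ (w ∷ []) ,
    trans Pu≡ (trans (cong (pre ++_) (pathF-child n pw (FinP.toℕ<n w)))
                     (sym (ListP.++-assoc pre (w ∷ []) (P q))))

  sumOver-Hpath-≤-P : ∀ (Q : Subset n) q {x : Fin n → ℚ} → (∀ i → 0ℚ ≤ℚ x i)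
    → sumOver (Hpath Q q) x ≤ℚ sumOver (P q) x
  sumOver-Hpath-≤-P Q q {x} x≥0 with P q | pathF-head n q
  ... | .(q ∷ rest) | rest , refl = ℚP.+-monoʳ-≤ (x q) (sumOver-takeWhile-≤ _ rest x≥0)

  sumOver-Hpath-≤-1 : ∀ (Q : Subset n) q {x : Fin n → ℚ} → (∀ i → 0ℚ ≤ℚ x i)
    → (∀ u → IsLeaf u → sumOver (P u) x ≤ℚ 1ℚ) → sumOver (Hpath Q q) x ≤ℚ 1ℚ
  sumOver-Hpath-≤-1 Q q {x} x≥0 leaf≤1 with leaf-below n q (ℕP.m≤m+n n (Fin.toℕ q))
  ... | u , u-leaf , pre , Pu≡ =
    ℚP.≤-trans (sumOver-Hpath-≤-P Q q x≥0)
      (ℚP.≤-trans (subst (sumOver (P q) x ≤ℚ_) (cong (λ L → sumOver L x) (sym Pu≡))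
                         (sumOver-suffix-≤ pre (P q) x≥0))
                  (leaf≤1 u u-leaf))

-- The inequality for q reads x(H_q) ≤ 1 if q ∈ Z, −x(H_q) ≤ 0 if q ∈ Q ∖ Z,
-- and 0 ≤ 0 if q ∉ Q; here A stands for q ∈ Z and B for q ∈ Q.
coefficient : ∀ {A B : Set} → Dec A → Dec B → ℚ
coefficient (yes _) _       = 1ℚ
coefficient (no _)  (yes _) = - 1ℚ
coefficient (no _)  (no _)  = 0ℚ

target : ∀ {A : Set} → Dec A → ℚ
target (yes _) = 1ℚ
target (no _)  = 0ℚ

-1*p≡-p : ∀ h → - 1ℚ * h ≡ - h
-1*p≡-p h = trans (sym (ℚP.neg-distribˡ-* 1ℚ h)) (cong -_ (ℚP.*-identityˡ h))

module _ {A B : Set} where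

  coefficient-*-≤-target : ∀ (a? : Dec A) (b? : Dec B) {h} → 0ℚ ≤ℚ h → h ≤ℚ 1ℚ
    → coefficient a? b? * h ≤ℚ target a?
  coefficient-*-≤-target (yes _) _       {h} h≥0 h≤1 = subst (_≤ℚ 1ℚ) (sym (ℚP.*-identityˡ h)) h≤1
  coefficient-*-≤-target (no _)  (yes _) {h} h≥0 h≤1 =
    subst (_≤ℚ 0ℚ) (sym (-1*p≡-p h)) (ℚP.neg-antimono-≤ h≥0)
  coefficient-*-≤-target (no _)  (no _)  {h} h≥0 h≤1 = ℚP.≤-reflexive (ℚP.*-zeroˡ h)

  coefficient-*-≡-target : ∀ (a? : Dec A) (b? : Dec B) {h} → (A → B)
    → (B → A → h ≡ 1ℚ) → (B → ¬ A → h ≡ 0ℚ) → coefficient a? b? * h ≡ target a?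
  coefficient-*-≡-target (yes a) _       {h} A⇒B h≡1 h≡0 = trans (ℚP.*-identityˡ h) (h≡1 (A⇒B a) a)
  coefficient-*-≡-target (no ¬a) (yes b) A⇒B h≡1 h≡0 =
    trans (cong (- 1ℚ *_) (h≡0 b ¬a)) (ℚP.*-zeroʳ (- 1ℚ))
  coefficient-*-≡-target (no _)  (no _)  {h} A⇒B h≡1 h≡0 = ℚP.*-zeroˡ h

  coefficient-*-≡-target⁻¹ : ∀ (a? : Dec A) (b? : Dec B) {h} → coefficient a? b? * h ≡ target a?
    → (B → A → h ≡ 1ℚ) × (B → ¬ A → h ≡ 0ℚ)
  coefficient-*-≡-target⁻¹ (yes a) _       {h} eq = (λ _ _ → trans (sym (ℚP.*-identityˡ h)) eq) , (λ _ ¬a → ⊥-elim (¬a a))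
  coefficient-*-≡-target⁻¹ (no ¬a) (yes b) {h} eq =
    (λ _ a → ⊥-elim (¬a a)) , λ _ _ → ℚP.neg-injective (trans (sym (-1*p≡-p h)) eq)
  coefficient-*-≡-target⁻¹ (no _)  (no ¬b) eq = (λ b _ → ⊥-elim (¬b b)) , (λ b _ → ⊥-elim (¬b b))

lemma9 : ∀ {n} (G : Tree n) (w : Fin n → ℕ) (B : ℕ → ℕ) (η : ℚ)
           → (∀ i → 1 ≤ i → i ≤ FF.L G → 0 < B i)
           → Data.Rational._<_ 0ℚ η
           → (Q : Subset n) → (∀ q → q ∈ Q → FF.Heavy G w η q)
           → (Z : Subset n) → Z ⊆ Q
           → IsFace (FF.FeasFF G B) (FF.FeasFFZ G B Q Z)
             × (∀ x → IsVertex (FF.FeasFFZ G B Q Z) x → IsVertex (FF.FeasFF G B) x)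
lemma9 {n} G _ B _ _ _ Q _ Z Z⊆Q = face , IsFace⇒IsVertex (FeasFF B) (FeasFFZ B Q Z) face
  where
  open FF G using (Hpath; FeasFF; FeasFFZ)
  s t : Fin n → ℚ
  s q = coefficient (q ∈? Z) (q ∈? Q)
  t q = target (q ∈? Z)
  c : Fin n → Fin n → ℚ
  c q i = s q * indicator (Hpath Q q) i
  dot-c : ∀ q x → dot (c q) x ≡ s q * sumOver (Hpath Q q) x
  dot-c q x = trans (dot-*ˡ (s q) (indicator (Hpath Q q)) x) (cong (s q *_) (dot-indicator (Hpath Q q) x))
  valid : ∀ x → FeasFF B x → ∀ q → dot (c q) x ≤ℚ t q
  valid x (x≥0 , leaf≤1 , _) q = subst (_≤ℚ t q) (sym (dot-c q x))
    (coefficient-*-≤-target (q ∈? Z) (q ∈? Q) (sumOver-nonNeg (Hpath Q q) x≥0)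
                            (sumOver-Hpath-≤-1 G Q q x≥0 leaf≤1))
  tight⇔ : ∀ x → FeasFFZ B Q Z x ⇔ (FeasFF B x × ∀ q → dot (c q) x ≡ t q)
  tight⇔ x = mk⇔
    (λ (feas , H≡1 , H≡0) → feas , λ q →
       trans (dot-c q x) (coefficient-*-≡-target (q ∈? Z) (q ∈? Q) Z⊆Q (H≡1 q) (H≡0 q)))
    (λ (feas , tight) →
       let H≡ q = coefficient-*-≡-target⁻¹ (q ∈? Z) (q ∈? Q) (trans (sym (dot-c q x)) (tight q))
       in feas , (λ q → proj₁ (H≡ q)) , (λ q → proj₂ (H≡ q)))
  face : IsFace (FeasFF B) (FeasFFZ B Q Z)
  face = IsFace-tightFamily (FeasFF B) (FeasFFZ B Q Z) c t valid tight⇔
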